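{- Let $m \ge 1$ and let $a_1 \le a_2 \le \dots \le a_{3m}$ and $B$ be positive integers with $\sum_{i=1}^{3m} a_i = mB$, $B/4 < a_i < B/2$ and $a_i \ge 8m$ for all $i$. Set $k = 3B$ and, for $i \in \{1,\dots,a_{3m}\}$, $\gamma_i = |\{ j \in \{1,\dots,3m\} : a_j \ge i\}|$. Let $G$ be the graph with vertex set $X \cup Y \cup Z$, where $X = \{x_1,\dots,x_{3m}\}$, $Y=\{y_1,\dots,y_{a_{3m}}\}$, $Z = \{z_1,\dots,z_{k - a_{3m}+1}\}$ are pairwise disjoint, and whose edges are exactly: all pairs within $X$, within $Y$, and within $Z$; $\{x_i,y_j\}$ for $i \in [3m]$ and $j \le a_i$; $\{y_i,z_j\}$ for $i \in [m]$ and $j \le |Z| - B - 12m + 15$; and $\{y_i,z_j\}$ for $i \in [m+1, a_{3m}]$ and $j \le |Z| - \gamma_i$. If there is a partition $(A_1,\dots,A_m)$ of $[3m]$ with $\sum_{j \in A_i} a_j = B$ for every $i \in [m]$, then $\mathrm{stc}(G) \le k$.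
   Context: $[n]=\{1,\dots,n\}$ and $[m,n]=\{d\in\mathbb{Z}: m\le d\le n\}$. For a connected graph $G$ and a spanning tree $T$, the congestion of an edge $e\in E(T)$ is the number of edges of $G$ between the vertex sets of the two components of $T-e$; the congestion of $T$ is the maximum over its edges; $\mathrm{stc}(G)$ is the minimum congestion of a spanning tree of $G$. -}

module Defs where

open import Data.Nat using (ℕ; zero; suc; _+_; _*_; _∸_; _≤_; _<_; _<ᵇ_; _≤ᵇ_; NonZero)
open import Data.Bool using (Bool; true; false; _∧_; _∨_; not; if_then_else_)
open import Data.Fin using (Fin; toℕ; fromℕ; splitAt; _≟_)
open import Data.Sum using (_⊎_; inj₁; inj₂)
open import Data.Product using (Σ; _×_; _,_)
open import Data.List using (List; []; _∷_; length)
open import Data.List.Relation.Unary.Unique.Propositional using (Unique)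
open import Relation.Nullary using (¬_)
open import Relation.Nullary.Decidable using (⌊_⌋)
open import Relation.Binary.PropositionalEquality using (_≡_)
open import Function using (_⇔_)

sumF : ∀ {n} → (Fin n → ℕ) → ℕ
sumF {zero}  f = 0
sumF {suc n} f = f Fin.zero + sumF (λ i → f (Fin.suc i))

countF : ∀ {n} → (Fin n → Bool) → ℕ
countF P = sumF (λ i → if P i then 1 else 0)

Adj : ℕ → Set
Adj n = Fin n → Fin n → Bool

data Reach {n} (H : Adj n) : Fin n → Fin n → Set where
  here : ∀ {u} → Reach H u u
  step : ∀ {u w v} → H u w ≡ true → Reach H w v → Reach H u v

Connected : ∀ {n} → Adj n → Set
Connected H = ∀ u v → Reach H u v

ClosedChain : ∀ {n} → Adj n → Fin n → List (Fin n) → Set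
ClosedChain H first []            = Data.Empty.⊥
  where import Data.Empty
ClosedChain H first (v ∷ [])      = H v first ≡ true
ClosedChain H first (v ∷ w ∷ vs)  = H v w ≡ true × ClosedChain H first (w ∷ vs)

IsCycle : ∀ {n} → Adj n → List (Fin n) → Set
IsCycle H []       = Data.Empty.⊥
  where import Data.Empty
IsCycle H (v ∷ vs) = 3 ≤ length (v ∷ vs) × Unique (v ∷ vs) × ClosedChain H v (v ∷ vs)

Acyclic : ∀ {n} → Adj n → Set
Acyclic H = ∀ c → ¬ IsCycle H c

record SpanningTree {n} (G : Adj n) (T : Adj n) : Set where
  field
    symm      : ∀ u v → T u v ≡ T v u
    loopless  : ∀ u → T u u ≡ false
    subgraph  : ∀ u v → T u v ≡ true → G u v ≡ true
    connected : Connected T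
    acyclic   : Acyclic T

deleteEdge : ∀ {n} → Adj n → Fin n → Fin n → Adj n
deleteEdge T u v p q =
  T p q ∧ not ((⌊ p ≟ u ⌋ ∧ ⌊ q ≟ v ⌋) ∨ (⌊ p ≟ v ⌋ ∧ ⌊ q ≟ u ⌋))

IsComponentOf : ∀ {n} → Adj n → Fin n → (Fin n → Bool) → Set
IsComponentOf H u S = ∀ w → (S w ≡ true) ⇔ Reach H u w

edgesBetween : ∀ {n} → Adj n → (Fin n → Bool) → (Fin n → Bool) → ℕ
edgesBetween G S₁ S₂ = sumF (λ p → countF (λ q → S₁ p ∧ S₂ q ∧ G p q))

EdgeCongestionLE : ∀ {n} → Adj n → Adj n → Fin n → Fin n → ℕ → Set
EdgeCongestionLE G T u v k =
  ∀ S₁ S₂ → IsComponentOf (deleteEdge T u v) u S₁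
          → IsComponentOf (deleteEdge T u v) v S₂
          → edgesBetween G S₁ S₂ ≤ k

CongestionLE : ∀ {n} → Adj n → Adj n → ℕ → Set
CongestionLE G T k = ∀ u v → T u v ≡ true → EdgeCongestionLE G T u v k

StcLE : ∀ {n} → Adj n → ℕ → Set
StcLE {n} G k = Σ (Adj n) λ T → SpanningTree G T × CongestionLE G T k

-- index of a_{3m} (0-based: 3m-1), for m ≥ 1
lastIdx : (m : ℕ) → .{{_ : NonZero m}} → Fin (3 * m)
lastIdx (suc m') = fromℕ _

gamma : ∀ {N} → (Fin N → ℕ) → ℕ → ℕ
gamma a i = countF (λ j → i ≤ᵇ a j)

-- a partition (A_1,…,A_m) of [3m], encoded by f : Fin (3m) → Fin m
-- (A_t = f⁻¹(t)); blockSum a f t = Σ_{j ∈ A_t} a_j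
blockSum : ∀ {N M} → (Fin N → ℕ) → (Fin N → Fin M) → Fin M → ℕ
blockSum a f t = sumF (λ j → if ⌊ f j ≟ t ⌋ then a j else 0)

-- vertices: Fin (p + (q + r)) split as X (size p) , Y (size q) , Z (size r)
data Part (p q r : ℕ) : Set where
  vx : Fin p → Part p q r
  vy : Fin q → Part p q r
  vz : Fin r → Part p q r

part : ∀ p q r → Fin (p + (q + r)) → Part p q r
part p q r v with splitAt p v
... | inj₁ i = vx i
... | inj₂ w with splitAt q w
...   | inj₁ j = vy j
...   | inj₂ l = vz l

-- Parameters: m, a : Fin (3m) → ℕ  (a (i-1) = a_i), B.
module Construction (m : ℕ) {{_ : NonZero m}} (a : Fin (3 * m) → ℕ) (B : ℕ) where

  k : ℕ
  k = 3 * B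

  aTop : ℕ
  aTop = a (lastIdx m)

  zSize : ℕ
  zSize = k ∸ aTop + 1

  nV : ℕ
  nV = 3 * m + (aTop + zSize)

  -- 1-based i ≤ c   ⇔   0-based i' < c
  -- oriented edge test (0-based indices); the adjacency is its symmetrisation
  edgeO : Part (3 * m) aTop zSize → Part (3 * m) aTop zSize → Bool
  edgeO (vx i) (vx j) = not ⌊ i ≟ j ⌋
  edgeO (vy i) (vy j) = not ⌊ i ≟ j ⌋
  edgeO (vz i) (vz j) = not ⌊ i ≟ j ⌋
  edgeO (vx i) (vy j) = toℕ j <ᵇ a i
  edgeO (vy i) (vz j) =
    if toℕ i <ᵇ m
    then toℕ j <ᵇ (zSize + 15) ∸ (B + 12 * m)
    else toℕ j <ᵇ zSize ∸ gamma a (suc (toℕ i))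
  edgeO _ _ = false

  G : Adj nV
  G u v = edgeO (part _ _ _ u) (part _ _ _ v) ∨ edgeO (part _ _ _ v) (part _ _ _ u)

{-# OPTIONS --safe #-}
-- The spanning tree is rooted at z₁: every other vertex of Z and every vertex of Y
-- hangs from z₁, and each x_j hangs from y_t where A_t is the block containing j.
-- Every tree edge except the m edges y_t z₁ (t ≤ m) ends in a leaf, whose congestion
-- is its degree in G, and the construction keeps all those degrees at most k.
-- Deleting y_t z₁ splits off {y_t} ∪ A_t.  Since B/4 < a_j < B/2, every block has
-- exactly three elements, and the G-edges leaving {y_t} ∪ A_t number at most
-- 4(3m − 3) + (B − 3) + (a_{3m} − 1) + (|Z| − B − 12m + 15) = |Y| + |Z| − 1 = k.

module Submission where

open import Defs
open import Data.Nat using (ℕ; zero; suc; _+_; _*_; _∸_; _≤_; _<_; _<ᵇ_; _<?_; NonZero; z≤n; s≤s; s≤s⁻¹; z<s)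
open import Data.Nat.Properties hiding (_≟_)
open import Data.Bool using (Bool; true; false; _∧_; _∨_; not; if_then_else_)
open import Data.Bool.Properties using (T-≡; T-not-≡; ¬-not; ∨-comm; ∨-identityʳ; ∧-comm; ∧-zeroʳ; ∧-identityʳ; ∧-conicalˡ)
open import Data.Fin using (Fin; toℕ; splitAt; _≟_; _↑ˡ_; _↑ʳ_; fromℕ<; inject≤)
open import Data.Fin.Base using () renaming (_≤_ to _≤ᶠ_)
open import Data.Fin.Properties using (toℕ<n; toℕ-fromℕ<; toℕ-inject≤; toℕ-injective; splitAt-↑ˡ; splitAt-↑ʳ; splitAt⁻¹-↑ˡ; splitAt⁻¹-↑ʳ)
open import Data.Product using (Σ; _×_; _,_)
open import Data.Sum using (_⊎_; inj₁; inj₂)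
open import Data.List using (List; []; _∷_; _++_; [_]; length)
open import Data.List.Properties using (++-assoc; ++-identityʳ; length-++)
open import Data.List.Relation.Unary.All as All using ([]; _∷_)
import Data.List.Relation.Unary.All.Properties as All
open import Data.List.Relation.Unary.AllPairs using ([]; _∷_)
open import Data.List.Relation.Unary.Any using (here; there)
import Data.List.Relation.Unary.Any.Properties as Any
open import Data.List.Membership.Propositional using (_∈_)
open import Data.List.Membership.Propositional.Properties using (∈-∃++)
open import Data.List.Relation.Unary.Unique.Propositional using (Unique)
open import Data.List.Extrema.Nat using (argmax; argmax-sel; f[⊥]≤f[argmax]; f[xs]≤f[argmax])
open import Data.Empty using (⊥)
open import Induction.WellFounded using (Acc; acc)
open import Data.Nat.Induction using (<-wellFounded)
open import Relation.Nullary using (contradiction; yes; no)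
open import Function using (_∘_; case_of_; Equivalence; mk⇔)
open import Relation.Nullary.Decidable using (⌊_⌋; ⌊⌋-map′; toWitness; fromWitness; fromWitnessFalse)
open import Relation.Binary.PropositionalEquality hiding ([_])
open import Data.Nat.Tactic.RingSolver using (solve-∀)
open import Algebra.Properties.Semiring.Sum +-*-semiring using (sum; sum-cong-≗; ∑-distrib-+; ∑-comm; *-distribˡ-sum)

private
  variable
    n : ℕ

⌊≟⌋-refl : (x : Fin n) → ⌊ x ≟ x ⌋ ≡ true
⌊≟⌋-refl x = Equivalence.to T-≡ (fromWitness refl)

⌊≟⌋-sound : {x y : Fin n} → ⌊ x ≟ y ⌋ ≡ true → x ≡ y
⌊≟⌋-sound e = toWitness (Equivalence.from T-≡ e)

⌊≟⌋-false : {x y : Fin n} → x ≢ y → ⌊ x ≟ y ⌋ ≡ false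
⌊≟⌋-false x≢y = Equivalence.to T-not-≡ (fromWitnessFalse x≢y)

<ᵇ-true : ∀ {i j} → i < j → (i <ᵇ j) ≡ true
<ᵇ-true i<j = Equivalence.to T-≡ (<⇒<ᵇ i<j)

<ᵇ-sound : ∀ {i j} → (i <ᵇ j) ≡ true → i < j
<ᵇ-sound {i} {j} e = <ᵇ⇒< i j (Equivalence.from T-≡ e)

<ᵇ-false : ∀ {i j} → j ≤ i → (i <ᵇ j) ≡ false
<ᵇ-false j≤i = ¬-not λ e → <⇒≱ (<ᵇ-sound e) j≤i

-- countF P and blockSum a f t are, definitionally, sums of restricted functions.
restrict : (Fin n → Bool) → (Fin n → ℕ) → Fin n → ℕ
restrict P g i = if P i then g i else 0

sumF≡sum : (g : Fin n → ℕ) → sumF g ≡ sum g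
sumF≡sum {zero}  g = refl
sumF≡sum {suc n} g = cong (g Fin.zero +_) (sumF≡sum (g ∘ Fin.suc))

sumF-cong : {g h : Fin n → ℕ} → (∀ i → g i ≡ h i) → sumF g ≡ sumF h
sumF-cong {zero}  g≗h = refl
sumF-cong {suc n} g≗h = cong₂ _+_ (g≗h Fin.zero) (sumF-cong (g≗h ∘ Fin.suc))

sumF-mono : {g h : Fin n → ℕ} → (∀ i → g i ≤ h i) → sumF g ≤ sumF h
sumF-mono {zero}  g≤h = z≤n
sumF-mono {suc n} g≤h = +-mono-≤ (g≤h Fin.zero) (sumF-mono (g≤h ∘ Fin.suc))

sumF-zero : sumF {n} (λ _ → 0) ≡ 0
sumF-zero {zero}  = refl
sumF-zero {suc n} = sumF-zero {n}

sumF-distrib-+ : (g h : Fin n → ℕ) → sumF (λ i → g i + h i) ≡ sumF g + sumF h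
sumF-distrib-+ g h = begin
  sumF (λ i → g i + h i) ≡⟨ sumF≡sum (λ i → g i + h i) ⟩
  sum (λ i → g i + h i)  ≡⟨ ∑-distrib-+ g h ⟩
  sum g + sum h          ≡⟨ cong₂ _+_ (sumF≡sum g) (sumF≡sum h) ⟨
  sumF g + sumF h        ∎
  where open ≡-Reasoning

sumF-*ˡ : ∀ c (g : Fin n → ℕ) → sumF (λ i → c * g i) ≡ c * sumF g
sumF-*ˡ c g = begin
  sumF (λ i → c * g i) ≡⟨ sumF≡sum (λ i → c * g i) ⟩
  sum (λ i → c * g i)  ≡⟨ *-distribˡ-sum c g ⟨
  c * sum g            ≡⟨ cong (c *_) (sumF≡sum g) ⟨
  c * sumF g           ∎
  where open ≡-Reasoning

sumF-comm : ∀ {n′} (h : Fin n → Fin n′ → ℕ) → sumF (λ i → sumF (h i)) ≡ sumF (λ j → sumF (λ i → h i j))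
sumF-comm h = begin
  sumF (λ i → sumF (h i))          ≡⟨ sumF≡sum (λ i → sumF (h i)) ⟩
  sum (λ i → sumF (h i))           ≡⟨ sum-cong-≗ (λ i → sumF≡sum (h i)) ⟩
  sum (λ i → sum (h i))            ≡⟨ ∑-comm h ⟩
  sum (λ j → sum (λ i → h i j))    ≡⟨ sum-cong-≗ (λ j → sumF≡sum (λ i → h i j)) ⟨
  sum (λ j → sumF (λ i → h i j))   ≡⟨ sumF≡sum (λ j → sumF (λ i → h i j)) ⟨
  sumF (λ j → sumF (λ i → h i j)) ∎
  where open ≡-Reasoning

sumF-↑ : ∀ p {q} (g : Fin (p + q) → ℕ) → sumF g ≡ sumF (g ∘ (_↑ˡ q)) + sumF (g ∘ (p ↑ʳ_))
sumF-↑ zero    g = refl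
sumF-↑ (suc p) g = trans (cong (g Fin.zero +_) (sumF-↑ p (g ∘ Fin.suc))) (sym (+-assoc (g Fin.zero) _ _))

sumF-point : (w : Fin n) (g : Fin n → ℕ) → sumF (restrict (λ i → ⌊ i ≟ w ⌋) g) ≡ g w
sumF-point {suc n} Fin.zero g = trans (cong (g Fin.zero +_) (sumF-zero {n})) (+-identityʳ (g Fin.zero))
sumF-point {suc n} (Fin.suc w) g = trans (sumF-cong λ i → cong (λ b → if b then g (Fin.suc i) else 0) (⌊⌋-map′ _ _ (i ≟ w)))
                                 (sumF-point w (g ∘ Fin.suc))

restrict-+ : (P : Fin n → Bool) (g h : Fin n → ℕ) → ∀ i → restrict P (λ j → g j + h j) i ≡ restrict P g i + restrict P h i
restrict-+ P g h i with P i
... | true  = refl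
... | false = refl

restrict-*ˡ : (P : Fin n → Bool) → ∀ c (g : Fin n → ℕ) i → restrict P (λ j → c * g j) i ≡ c * restrict P g i
restrict-*ˡ P c g i with P i
... | true  = refl
... | false = sym (*-zeroʳ c)

restrict-const : (P : Fin n → Bool) → ∀ c i → restrict P (λ _ → c) i ≡ c * restrict P (λ _ → 1) i
restrict-const P c i with P i
... | true  = sym (*-identityʳ c)
... | false = sym (*-zeroʳ c)

sumF-restrict-mono : (P : Fin n → Bool) {g h : Fin n → ℕ} → (∀ i → P i ≡ true → g i ≤ h i)
                   → sumF (restrict P g) ≤ sumF (restrict P h)
sumF-restrict-mono P {g} {h} g≤h = sumF-mono pointwise
  where
  pointwise : ∀ i → restrict P g i ≤ restrict P h i
  pointwise i with P i in Pi
  ... | true  = g≤h i Pi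
  ... | false = z≤n

sumF-restrict-+ : (P : Fin n → Bool) (g h : Fin n → ℕ)
                → sumF (restrict P (λ i → g i + h i)) ≡ sumF (restrict P g) + sumF (restrict P h)
sumF-restrict-+ P g h = trans (sumF-cong (restrict-+ P g h)) (sumF-distrib-+ (restrict P g) (restrict P h))

sumF-restrict-*ˡ : (P : Fin n → Bool) → ∀ c (g : Fin n → ℕ) → sumF (restrict P (λ i → c * g i)) ≡ c * sumF (restrict P g)
sumF-restrict-*ˡ P c g = trans (sumF-cong (restrict-*ˡ P c g)) (sumF-*ˡ c (restrict P g))

sumF-restrict-const : (P : Fin n → Bool) → ∀ c → sumF (restrict P (λ _ → c)) ≡ c * countF P
sumF-restrict-const P c = trans (sumF-cong (restrict-const P c)) (sumF-*ˡ c (restrict P (λ _ → 1)))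

countF-cong : {P Q : Fin n → Bool} → (∀ i → P i ≡ Q i) → countF P ≡ countF Q
countF-cong P≗Q = sumF-cong λ i → cong (λ b → if b then 1 else 0) (P≗Q i)

countF-mono : {P Q : Fin n → Bool} → (∀ i → P i ≡ true → Q i ≡ true) → countF P ≤ countF Q
countF-mono {P = P} {Q} P⇒Q = sumF-mono pointwise
  where
  pointwise : ∀ i → (if P i then 1 else 0) ≤ (if Q i then 1 else 0)
  pointwise i with P i in Pi
  ... | false = z≤n
  ... | true rewrite P⇒Q i Pi = ≤-refl

countF-true : countF {n} (λ _ → true) ≡ n
countF-true {zero}  = refl
countF-true {suc n} = cong suc (countF-true {n})

countF-≤ : (P : Fin n → Bool) → countF P ≤ n
countF-≤ {n} P = ≤-trans (countF-mono {P = P} {Q = λ _ → true} (λ _ _ → refl)) (≤-reflexive (countF-true {n}))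

countF-complement : (P : Fin n → Bool) → countF P + countF (not ∘ P) ≡ n
countF-complement {zero}  P = refl
countF-complement {suc n} P with P Fin.zero
... | true  = cong suc (countF-complement (P ∘ Fin.suc))
... | false = trans (+-suc _ _) (cong suc (countF-complement (P ∘ Fin.suc)))

countF-toℕ<ᵇ : ∀ c → countF {n} (λ i → toℕ i <ᵇ c) ≤ c
countF-toℕ<ᵇ {zero}  c       = z≤n
countF-toℕ<ᵇ {suc n} zero    = ≤-reflexive (sumF-zero {n})
countF-toℕ<ᵇ {suc n} (suc c) = s≤s (countF-toℕ<ᵇ {n} c)

countF-toℕ< : ∀ c {Q : Fin n → Bool} → (∀ i → Q i ≡ true → toℕ i < c) → countF Q ≤ c
countF-toℕ< {n} c {Q} Q⇒< =
  ≤-trans (countF-mono {P = Q} {Q = λ i → toℕ i <ᵇ c} λ i Qi → <ᵇ-true (Q⇒< i Qi)) (countF-toℕ<ᵇ {n} c)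

countF-except : {Q : Fin n → Bool} (w : Fin n) → Q w ≡ true → suc (countF (λ i → not ⌊ i ≟ w ⌋ ∧ Q i)) ≡ countF Q
countF-except {suc n} Fin.zero Qw rewrite Qw = refl
countF-except {suc n} {Q} (Fin.suc w) Qw = begin
  suc (q₀ + countF (λ i → not ⌊ Fin.suc i ≟ Fin.suc w ⌋ ∧ Q (Fin.suc i)))
    ≡⟨ cong (λ c → suc (q₀ + c)) (countF-cong λ i → cong (λ b → not b ∧ Q (Fin.suc i)) (⌊⌋-map′ _ _ (i ≟ w))) ⟩
  suc (q₀ + countF (λ i → not ⌊ i ≟ w ⌋ ∧ Q (Fin.suc i)))
    ≡⟨ +-suc q₀ _ ⟨
  q₀ + suc (countF (λ i → not ⌊ i ≟ w ⌋ ∧ Q (Fin.suc i)))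
    ≡⟨ cong (q₀ +_) (countF-except w Qw) ⟩
  q₀ + countF (Q ∘ Fin.suc) ∎
  where
  open ≡-Reasoning
  q₀ = if Q Fin.zero then 1 else 0

countF-except-< : (w : Fin n) (Q : Fin n → Bool) → countF (λ i → not ⌊ i ≟ w ⌋ ∧ Q i) < n
countF-except-< {n} w Q = begin
  suc (countF (λ i → not ⌊ i ≟ w ⌋ ∧ Q i))    ≤⟨ s≤s (countF-mono {n} λ i e → trans (∧-identityʳ _) (∧-conicalˡ _ _ e)) ⟩
  suc (countF (λ i → not ⌊ i ≟ w ⌋ ∧ true))   ≡⟨ countF-except w refl ⟩
  countF {n} (λ _ → true)                      ≡⟨ countF-true ⟩
  n                                            ∎
  where open ≤-Reasoning

countF-clique-< : (w : Fin n) → countF (λ i → not ⌊ w ≟ i ⌋ ∨ not ⌊ i ≟ w ⌋) < n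
countF-clique-< {n} w = ≤-trans (s≤s (countF-mono {n} pointwise)) (countF-except-< w (λ _ → true))
  where
  pointwise : ∀ i → not ⌊ w ≟ i ⌋ ∨ not ⌊ i ≟ w ⌋ ≡ true → not ⌊ i ≟ w ⌋ ∧ true ≡ true
  pointwise i e with i ≟ w
  ... | no _     = refl
  ... | yes refl = contradiction (trans (sym e) (cong (λ b → not b ∨ false) (⌊≟⌋-refl i))) λ ()

Symmetric : Adj n → Set
Symmetric H = ∀ p q → H p q ≡ H q p

_⊆ᵇ_ : (Fin n → Bool) → (Fin n → Bool) → Set
S ⊆ᵇ E = ∀ p → S p ≡ true → E p ≡ true

Closed : Adj n → (Fin n → Bool) → Set
Closed H E = ∀ p q → E p ≡ true → H p q ≡ true → E q ≡ true

module _ {H : Adj n} where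

  reach-trans : ∀ {u v w} → Reach H u v → Reach H v w → Reach H u w
  reach-trans here       r′ = r′
  reach-trans (step e r) r′ = step e (reach-trans r r′)

  reach-sym : Symmetric H → ∀ {u v} → Reach H u v → Reach H v u
  reach-sym H-sym here               = here
  reach-sym H-sym (step {u} {w} e r) = reach-trans (reach-sym H-sym r) (step (trans (H-sym w u) e) here)

  reach-closed : ∀ {E u w} → Closed H E → E u ≡ true → Reach H u w → E w ≡ true
  reach-closed closed Eu here               = Eu
  reach-closed closed Eu (step {u} {w} e r) = reach-closed closed (closed u w Eu e) r

  closed-complement : ∀ {E} → Symmetric H → Closed H E → Closed H (not ∘ E)
  closed-complement {E} H-sym closed p q ¬Ep Hpq with E q in Eq
  ... | false = refl
  ... | true  = contradiction (trans (sym ¬Ep) (cong not (closed q p Eq (trans (H-sym q p) Hpq)))) λ ()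

  component-⊆ : ∀ {E u S} → Closed H E → E u ≡ true → IsComponentOf H u S → S ⊆ᵇ E
  component-⊆ closed Eu comp w Sw = reach-closed closed Eu (Equivalence.to (comp w) Sw)

reach-cong : {H H′ : Adj n} → (∀ p q → H p q ≡ H′ p q) → ∀ {u v} → Reach H u v → Reach H′ u v
reach-cong H≗H′ here               = here
reach-cong H≗H′ (step {u} {w} e r) = step (trans (sym (H≗H′ u w)) e) (reach-cong H≗H′ r)

component-cong : {H H′ : Adj n} → (∀ p q → H p q ≡ H′ p q) → ∀ {u S} → IsComponentOf H u S → IsComponentOf H′ u S
component-cong H≗H′ comp w = mk⇔ (reach-cong H≗H′ ∘ Equivalence.to (comp w))
                                 (Equivalence.from (comp w) ∘ reach-cong (λ p q → sym (H≗H′ p q)))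

module _ (T : Adj n) (u v : Fin n) where

  deleteEdge-comm : ∀ p q → deleteEdge T u v p q ≡ deleteEdge T v u p q
  deleteEdge-comm p q = cong (λ b → T p q ∧ not b) (∨-comm (⌊ p ≟ u ⌋ ∧ ⌊ q ≟ v ⌋) (⌊ p ≟ v ⌋ ∧ ⌊ q ≟ u ⌋))

  deleteEdge-symmetric : Symmetric T → Symmetric (deleteEdge T u v)
  deleteEdge-symmetric T-sym p q = cong₂ (λ t b → t ∧ not b) (T-sym p q) (begin
    (⌊ p ≟ u ⌋ ∧ ⌊ q ≟ v ⌋) ∨ (⌊ p ≟ v ⌋ ∧ ⌊ q ≟ u ⌋) ≡⟨ ∨-comm (⌊ p ≟ u ⌋ ∧ ⌊ q ≟ v ⌋) _ ⟩
    (⌊ p ≟ v ⌋ ∧ ⌊ q ≟ u ⌋) ∨ (⌊ p ≟ u ⌋ ∧ ⌊ q ≟ v ⌋) ≡⟨ cong₂ _∨_ (∧-comm ⌊ p ≟ v ⌋ _) (∧-comm ⌊ p ≟ u ⌋ _) ⟩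
    (⌊ q ≟ u ⌋ ∧ ⌊ p ≟ v ⌋) ∨ (⌊ q ≟ v ⌋ ∧ ⌊ p ≟ u ⌋) ∎)
    where open ≡-Reasoning

  deleteEdge-self : deleteEdge T u v u v ≡ false
  deleteEdge-self rewrite ⌊≟⌋-refl u | ⌊≟⌋-refl v = ∧-zeroʳ (T u v)

degreeInto : Adj n → (Fin n → Bool) → Fin n → ℕ
degreeInto G S p = countF (λ q → S q ∧ G p q)

module _ (G : Adj n) where

  edgesBetween-degreeInto : ∀ S₁ S₂ → edgesBetween G S₁ S₂ ≡ sumF (restrict S₁ (degreeInto G S₂))
  edgesBetween-degreeInto S₁ S₂ = sumF-cong pointwise
    where
    pointwise : ∀ p → countF (λ q → S₁ p ∧ S₂ q ∧ G p q) ≡ restrict S₁ (degreeInto G S₂) p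
    pointwise p with S₁ p
    ... | true  = refl
    ... | false = sumF-zero {n}

  edgesBetween-mono : ∀ {S₁ S₂ E₁ E₂} → S₁ ⊆ᵇ E₁ → S₂ ⊆ᵇ E₂ → edgesBetween G S₁ S₂ ≤ edgesBetween G E₁ E₂
  edgesBetween-mono {S₁} {S₂} {E₁} {E₂} S₁⊆E₁ S₂⊆E₂ =
    sumF-mono λ p → countF-mono λ q → pointwise p q (S₁ p) (S₂ q) refl refl
    where
    pointwise : ∀ p q b₁ b₂ → S₁ p ≡ b₁ → S₂ q ≡ b₂ → b₁ ∧ b₂ ∧ G p q ≡ true → E₁ p ∧ E₂ q ∧ G p q ≡ true
    pointwise p q true  true  S₁p S₂q e rewrite S₁⊆E₁ p S₁p | S₂⊆E₂ q S₂q = e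
    pointwise p q true  false S₁p S₂q ()
    pointwise p q false b₂    S₁p S₂q ()

  edgesBetween-comm : Symmetric G → ∀ S₁ S₂ → edgesBetween G S₁ S₂ ≡ edgesBetween G S₂ S₁
  edgesBetween-comm G-sym S₁ S₂ =
    trans (sumF-comm (λ p q → if S₁ p ∧ S₂ q ∧ G p q then 1 else 0))
          (sumF-cong λ q → countF-cong λ p → swap (S₁ p) (S₂ q) (G-sym p q))
    where
    swap : ∀ b₁ b₂ {g g′} → g ≡ g′ → b₁ ∧ b₂ ∧ g ≡ b₂ ∧ b₁ ∧ g′
    swap true  true  refl = refl
    swap true  false refl = refl
    swap false true  refl = refl
    swap false false refl = refl

module _ {G T : Adj n} {k : ℕ} where

  congestion-flip : Symmetric G → ∀ {u v} → EdgeCongestionLE G T u v k → EdgeCongestionLE G T v u k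
  congestion-flip G-sym {u} {v} h S₁ S₂ c₁ c₂ =
    ≤-trans (≤-reflexive (edgesBetween-comm G G-sym S₁ S₂))
            (h S₂ S₁ (component-cong (deleteEdge-comm T v u) c₂) (component-cong (deleteEdge-comm T v u) c₁))

  congestion-≤-cut : Symmetric T → ∀ {u v E} → Closed (deleteEdge T u v) E → E u ≡ true → E v ≡ false
                   → edgesBetween G E (not ∘ E) ≤ k → EdgeCongestionLE G T u v k
  congestion-≤-cut T-sym {u} {v} closed Eu Ev cut S₁ S₂ c₁ c₂ =
    ≤-trans (edgesBetween-mono G (component-⊆ closed Eu c₁)
              (component-⊆ (closed-complement (deleteEdge-symmetric T u v T-sym) closed) (cong not Ev) c₂))
            cut

  congestion-leaf : ∀ {u v} → (∀ q → T u q ≡ true → q ≡ v) → countF (G u) ≤ k → EdgeCongestionLE G T u v k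
  congestion-leaf {u} {v} leaf deg S₁ S₂ c₁ c₂ = begin
    edgesBetween G S₁ S₂                                            ≤⟨ edgesBetween-mono G (component-⊆ closed (⌊≟⌋-refl u) c₁) (λ _ _ → refl) ⟩
    edgesBetween G (λ w → ⌊ w ≟ u ⌋) (λ _ → true)                   ≡⟨ edgesBetween-degreeInto G _ _ ⟩
    sumF (restrict (λ w → ⌊ w ≟ u ⌋) (degreeInto G (λ _ → true)))  ≡⟨ sumF-point u _ ⟩
    countF (G u)                                                    ≤⟨ deg ⟩
    k                                                               ∎
    where
    open ≤-Reasoning
    closed : Closed (deleteEdge T u v) (λ w → ⌊ w ≟ u ⌋)
    closed p q p≡u e with ⌊≟⌋-sound p≡u
    ... | refl with leaf q (∧-conicalˡ _ _ e)
    ...   | refl = contradiction (trans (sym e) (deleteEdge-self T p q)) λ ()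

module _ {H : Adj n} where

  closedChain-snoc : ∀ {f g} x l → ClosedChain H f (x ∷ l) → H f g ≡ true → ClosedChain H g (x ∷ l ++ [ f ])
  closedChain-snoc x []      Hxf       Hfg = Hxf , Hfg
  closedChain-snoc x (y ∷ l) (Hxy , c) Hfg = Hxy , closedChain-snoc y l c Hfg

  closedChain-last : ∀ {f} x y l → ClosedChain H f (x ∷ y ∷ l) → Σ (Fin n) λ z → z ∈ (y ∷ l) × H z f ≡ true
  closedChain-last x y []      (_ , Hyf) = y , here refl , Hyf
  closedChain-last x y (z ∷ l) (_ , c)   with closedChain-last y z l c
  ... | w , w∈ , Hwf = w , there w∈ , Hwf

  unique-snoc : ∀ (v : Fin n) l → Unique (v ∷ l) → Unique (l ++ [ v ])
  unique-snoc v []      _                              = [] ∷ []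
  unique-snoc v (x ∷ l) ((v≢x ∷ v∉l) ∷ (x∉l ∷ unique-l)) =
    All.++⁺ x∉l ((λ x≡v → v≢x (sym x≡v)) ∷ []) ∷ unique-snoc v l (v∉l ∷ unique-l)

  isCycle-rotate₁ : ∀ v w l → IsCycle H (v ∷ w ∷ l) → IsCycle H (w ∷ l ++ [ v ])
  isCycle-rotate₁ v w l (3≤len , unique , Hvw , c) =
    subst (3 ≤_) (sym length-eq) 3≤len , unique-snoc v (w ∷ l) unique , closedChain-snoc w l c Hvw
    where
    length-eq : length (w ∷ l ++ [ v ]) ≡ length (v ∷ w ∷ l)
    length-eq = cong suc (trans (length-++ l) (+-comm (length l) 1))

  isCycle-rotate : ∀ pre u post → IsCycle H (pre ++ u ∷ post) → IsCycle H (u ∷ post ++ pre)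
  isCycle-rotate []            u post c = subst (IsCycle H) (cong (u ∷_) (sym (++-identityʳ post))) c
  isCycle-rotate (x ∷ [])      u post c = isCycle-rotate₁ x u post c
  isCycle-rotate (x ∷ y ∷ pre) u post c =
    subst (IsCycle H) (cong (u ∷_) (++-assoc post [ x ] (y ∷ pre)))
      (isCycle-rotate (y ∷ pre) u (post ++ [ x ])
        (subst (IsCycle H) (cong (y ∷_) (++-assoc pre (u ∷ post) [ x ])) (isCycle-rotate₁ x y (pre ++ u ∷ post) c)))

module ParentTree (root : Fin n) (parent : Fin n → Fin n) (rank : Fin n → ℕ)
                  (rank-parent : ∀ u → u ≢ root → rank (parent u) < rank u) where

  isParentEdge : Fin n → Fin n → Bool
  isParentEdge u v = not ⌊ u ≟ root ⌋ ∧ ⌊ parent u ≟ v ⌋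

  tree : Adj n
  tree u v = isParentEdge u v ∨ isParentEdge v u

  isParentEdge-sound : ∀ {u v} → isParentEdge u v ≡ true → u ≢ root × parent u ≡ v
  isParentEdge-sound {u} e with u ≟ root
  ... | no u≢root = u≢root , ⌊≟⌋-sound e

  tree-edge : ∀ u v → tree u v ≡ true → (u ≢ root × parent u ≡ v) ⊎ (v ≢ root × parent v ≡ u)
  tree-edge u v e with isParentEdge u v in e₁
  ... | true  = inj₁ (isParentEdge-sound e₁)
  ... | false = inj₂ (isParentEdge-sound e)

  tree-parent : ∀ {u} → u ≢ root → tree u (parent u) ≡ true
  tree-parent {u} u≢root rewrite ⌊≟⌋-false u≢root | ⌊≟⌋-refl (parent u) = refl

  tree-symmetric : Symmetric tree
  tree-symmetric u v = ∨-comm (isParentEdge u v) (isParentEdge v u)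

  tree-loopless : ∀ u → tree u u ≡ false
  tree-loopless u with isParentEdge u u in e
  ... | false = refl
  ... | true  with u≢root , parent-u≡u ← isParentEdge-sound e =
    contradiction (subst (λ w → rank w < rank u) parent-u≡u (rank-parent u u≢root)) (<-irrefl refl)

  reach-root : ∀ u → Acc _<_ (rank u) → Reach tree u root
  reach-root u (acc rs) with u ≟ root
  ... | yes refl  = here
  ... | no u≢root = step (tree-parent u≢root) (reach-root (parent u) (rs (rank-parent u u≢root)))

  tree-connected : Connected tree
  tree-connected u v = reach-trans (reach-root u (<-wellFounded _))
                                   (reach-sym tree-symmetric (reach-root v (<-wellFounded _)))

  tree-edge-rank : ∀ u v → tree u v ≡ true → (parent u ≡ v × rank v < rank u) ⊎ (parent v ≡ u × rank u < rank v)
  tree-edge-rank u v e with tree-edge u v e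
  ... | inj₁ (u≢root , refl) = inj₁ (refl , rank-parent u u≢root)
  ... | inj₂ (v≢root , refl) = inj₂ (refl , rank-parent v v≢root)

  -- Both cycle-neighbours of a vertex of maximal rank would have to be its parent.
  no-cycle-through-max : ∀ u vs → IsCycle tree (u ∷ vs) → (∀ w → w ∈ vs → rank w ≤ rank u) → ⊥
  no-cycle-through-max u []           (s≤s () , _)       _
  no-cycle-through-max u (w ∷ [])     (s≤s (s≤s ()) , _) _
  no-cycle-through-max u (w ∷ r ∷ rs) (_ , (_ ∷ (w∉ ∷ _)) , Huw , c) u-max
    with z , z∈ , Hzu ← closedChain-last w r rs c
    with tree-edge-rank u w Huw | tree-edge-rank z u Hzu
  ... | inj₂ (_ , u<w) | _              = <⇒≱ u<w (u-max w (here refl))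
  ... | inj₁ _         | inj₁ (_ , u<z) = <⇒≱ u<z (u-max z (there z∈))
  ... | inj₁ (p≡w , _) | inj₂ (p≡z , _) = All.lookup w∉ z∈ (trans (sym p≡w) p≡z)

  tree-acyclic : Acyclic tree
  tree-acyclic []       ()
  tree-acyclic (x ∷ xs) cyc = rotate-to-max (∈-∃++ u∈)
    where
    u = argmax rank x xs
    u∈ : u ∈ (x ∷ xs)
    u∈ with argmax-sel rank x xs
    ... | inj₁ u≡x  = here u≡x
    ... | inj₂ u∈xs = there u∈xs
    u-max : ∀ w → w ∈ (x ∷ xs) → rank w ≤ rank u
    u-max w (here refl) = f[⊥]≤f[argmax] {f = rank} x xs
    u-max w (there w∈)  = All.lookup (f[xs]≤f[argmax] {f = rank} x xs) w∈
    rotate-to-max : (Σ (List (Fin n)) λ pre → Σ (List (Fin n)) λ post → x ∷ xs ≡ pre ++ u ∷ post) → ⊥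
    rotate-to-max (pre , post , xs≡) =
      no-cycle-through-max u (post ++ pre) (isCycle-rotate pre u post (subst (IsCycle tree) xs≡ cyc))
        λ w w∈ → u-max w (subst (w ∈_) (sym xs≡) (Any.++-comm (u ∷ post) pre (there w∈)))

  module _ {G : Adj n} where

    tree-spanning : Symmetric G → (∀ u → u ≢ root → G u (parent u) ≡ true) → SpanningTree G tree
    tree-spanning G-sym G-parent = record
      { symm      = tree-symmetric
      ; loopless  = tree-loopless
      ; subgraph  = subgraph
      ; connected = tree-connected
      ; acyclic   = tree-acyclic
      }
      where
      subgraph : ∀ u v → tree u v ≡ true → G u v ≡ true
      subgraph u v e with tree-edge u v e
      ... | inj₁ (u≢root , refl) = G-parent u u≢root
      ... | inj₂ (v≢root , refl) = trans (G-sym u v) (G-parent v v≢root)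

    tree-congestion : ∀ {k} → Symmetric G → (∀ u → u ≢ root → EdgeCongestionLE G tree u (parent u) k)
                    → CongestionLE G tree k
    tree-congestion G-sym h u v e with tree-edge u v e
    ... | inj₁ (u≢root , refl) = h u u≢root
    ... | inj₂ (v≢root , refl) = congestion-flip G-sym (h v v≢root)

  tree-leaf : ∀ {u} → (∀ w → w ≢ root → parent w ≢ u) → ∀ q → tree u q ≡ true → q ≡ parent u
  tree-leaf {u} childless q e with tree-edge u q e
  ... | inj₁ (_ , refl)            = refl
  ... | inj₂ (q≢root , parent-q≡u) = contradiction parent-q≡u (childless q q≢root)

  tree-cut-closed : ∀ u (E : Fin n → Bool) → (∀ w → w ≢ root → w ≢ u → E w ≡ E (parent w))
                  → Closed (deleteEdge tree u (parent u)) E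
  tree-cut-closed u E E-parent p q Ep e with tree-edge p q (∧-conicalˡ _ _ e)
  ... | inj₁ (p≢root , refl) = case p ≟ u of λ where
    (yes refl) → contradiction (trans (sym e) (deleteEdge-self tree p (parent p))) λ ()
    (no p≢u)   → trans (sym (E-parent p p≢root p≢u)) Ep
  ... | inj₂ (q≢root , refl) = case q ≟ u of λ where
    (yes refl) → contradiction (trans (sym e) (trans (deleteEdge-comm tree q (parent q) (parent q) q)
                                                     (deleteEdge-self tree (parent q) q))) λ ()
    (no q≢u)   → trans (E-parent q q≢root q≢u) Ep

module ThreeParts (p q r : ℕ) where

  embed : Part p q r → Fin (p + (q + r))
  embed (vx i) = i ↑ˡ (q + r)
  embed (vy j) = p ↑ʳ (j ↑ˡ r)
  embed (vz l) = p ↑ʳ (q ↑ʳ l)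

  part-embed : ∀ x → part p q r (embed x) ≡ x
  part-embed (vx i) rewrite splitAt-↑ˡ p i (q + r) = refl
  part-embed (vy j) rewrite splitAt-↑ʳ p (q + r) (j ↑ˡ r) | splitAt-↑ˡ q j r = refl
  part-embed (vz l) rewrite splitAt-↑ʳ p (q + r) (q ↑ʳ l) | splitAt-↑ʳ q r l = refl

  embed-part : ∀ v → embed (part p q r v) ≡ v
  embed-part v with splitAt p v in e
  ... | inj₁ i = splitAt⁻¹-↑ˡ e
  ... | inj₂ w with splitAt q w in e′
  ...   | inj₁ j = trans (cong (p ↑ʳ_) (splitAt⁻¹-↑ˡ e′)) (splitAt⁻¹-↑ʳ e)
  ...   | inj₂ l = trans (cong (p ↑ʳ_) (splitAt⁻¹-↑ʳ e′)) (splitAt⁻¹-↑ʳ e)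

  embed-injective : ∀ {x y} → embed x ≡ embed y → x ≡ y
  embed-injective {x} {y} e = trans (sym (part-embed x)) (trans (cong (part p q r) e) (part-embed y))

  sumParts : (Part p q r → ℕ) → ℕ
  sumParts g = sumF (g ∘ vx) + (sumF (g ∘ vy) + sumF (g ∘ vz))

  part-≢ : ∀ {w x} → w ≢ embed x → part p q r w ≢ x
  part-≢ {w} w≢ e = w≢ (trans (sym (embed-part w)) (cong embed e))

  sumF-part : (g : Part p q r → ℕ) → sumF (g ∘ part p q r) ≡ sumParts g
  sumF-part g = trans (sumF-↑ p (g ∘ part p q r))
    (cong₂ _+_ (sumF-cong (cong g ∘ part-embed ∘ vx))
               (trans (sumF-↑ q (g ∘ part p q r ∘ (p ↑ʳ_)))
                      (cong₂ _+_ (sumF-cong (cong g ∘ part-embed ∘ vy)) (sumF-cong (cong g ∘ part-embed ∘ vz)))))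

three-from-bounds : ∀ s {B} → 1 ≤ B → s * suc B ≤ 4 * B → s + 2 * B ≤ s * B → s ≡ 3
three-from-bounds zero        1≤B _  2B≤0 = contradiction (≤-trans (*-monoʳ-≤ 2 1≤B) 2B≤0) λ ()
three-from-bounds s@(suc s′) {B} _ upper lower = ≤-antisym (s≤s⁻¹ s<4) 2<s
  where
  s<4 : s < 4
  s<4 = *-cancelʳ-< (suc B) s 4 (≤-<-trans upper (*-monoʳ-< 4 (n<1+n B)))
  2<s : 2 < s
  2<s = *-cancelʳ-< B 2 s (<-≤-trans (m<n+m (2 * B) {s} z<s) lower)

block-card≡3 : ∀ {N} {a : Fin N → ℕ} {B} (P : Fin N → Bool) → 1 ≤ B → (∀ i → B < 4 * a i) → (∀ i → 2 * a i < B)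
             → sumF (restrict P a) ≡ B → countF P ≡ 3
block-card≡3 {a = a} {B} P 1≤B B<4a 2a<B ΣPa≡B = three-from-bounds s 1≤B upper lower
  where
  open ≤-Reasoning
  s = countF P
  upper : s * suc B ≤ 4 * B
  upper = begin
    s * suc B                           ≡⟨ *-comm s (suc B) ⟩
    suc B * s                           ≡⟨ sumF-restrict-const P (suc B) ⟨
    sumF (restrict P (λ _ → suc B))     ≤⟨ sumF-restrict-mono P (λ i _ → B<4a i) ⟩
    sumF (restrict P (λ i → 4 * a i))   ≡⟨ sumF-restrict-*ˡ P 4 a ⟩
    4 * sumF (restrict P a)             ≡⟨ cong (4 *_) ΣPa≡B ⟩
    4 * B                               ∎
  lower : s + 2 * B ≤ s * B
  lower = begin
    s + 2 * B                               ≡⟨ cong (λ b → s + 2 * b) ΣPa≡B ⟨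
    s + 2 * sumF (restrict P a)             ≡⟨ cong (s +_) (sumF-restrict-*ˡ P 2 a) ⟨
    s + sumF (restrict P (λ i → 2 * a i))   ≡⟨ sumF-restrict-+ P (λ _ → 1) (λ i → 2 * a i) ⟨
    sumF (restrict P (λ i → suc (2 * a i))) ≤⟨ sumF-restrict-mono P (λ i _ → 2a<B i) ⟩
    sumF (restrict P (λ _ → B))             ≡⟨ sumF-restrict-const P B ⟩
    B * s                                   ≡⟨ *-comm B s ⟩
    s * B                                   ∎

module LowCongestionTree (m : ℕ) {{_ : NonZero m}} (a : Fin (3 * m) → ℕ) (B : ℕ)
  (1≤B : 1 ≤ B) (B<4a : ∀ i → B < 4 * a i) (2a<B : ∀ i → 2 * a i < B) (8m≤a : ∀ i → 8 * m ≤ a i)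
  (f : Fin (3 * m) → Fin m) (f-blocks : ∀ t → blockSum a f t ≡ B) where

  open Construction m a B
  open ThreeParts (3 * m) aTop zSize

  V : Set
  V = Part (3 * m) aTop zSize

  partV : Fin nV → V
  partV = part (3 * m) aTop zSize

  GV : V → V → Bool
  GV x y = edgeO x y ∨ edgeO y x

  G-symmetric : Symmetric G
  G-symmetric u v = ∨-comm (edgeO (partV u) (partV v)) _

  G-embed : ∀ x y → G (embed x) (embed y) ≡ GV x y
  G-embed x y rewrite part-embed x | part-embed y = refl

  a<B : ∀ j → a j < B
  a<B j = ≤-<-trans (m≤m+n (a j) (a j + 0)) (2a<B j)

  aTop<B : aTop < B
  aTop<B = a<B (lastIdx m)

  16m<B : 16 * m < B
  16m<B = begin-strict
    16 * m      ≡⟨ *-assoc 2 8 m ⟩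
    2 * (8 * m) ≤⟨ *-monoʳ-≤ 2 (8m≤a (lastIdx m)) ⟩
    2 * aTop    <⟨ 2a<B (lastIdx m) ⟩
    B           ∎
    where open ≤-Reasoning

  3m<B : 3 * m < B
  3m<B = ≤-<-trans (*-monoˡ-≤ m {3} {16} (≤-trans (n≤1+n 3) (m≤m+n 4 12))) 16m<B

  12m<B : 12 * m < B
  12m<B = ≤-<-trans (*-monoˡ-≤ m {12} {16} (m≤m+n 12 4)) 16m<B

  |Y|+|Z|≡k+1 : aTop + zSize ≡ suc k
  |Y|+|Z|≡k+1 = begin
    aTop + (k ∸ aTop + 1) ≡⟨ +-assoc aTop (k ∸ aTop) 1 ⟨
    aTop + (k ∸ aTop) + 1 ≡⟨ cong (_+ 1) (m+[n∸m]≡n (≤-trans (<⇒≤ aTop<B) (m≤m+n B _))) ⟩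
    k + 1                 ≡⟨ +-comm k 1 ⟩
    suc k                 ∎
    where open ≡-Reasoning

  2B<|Z| : B + B < zSize
  2B<|Z| = +-cancelˡ-< aTop (B + B) zSize (begin-strict
    aTop + (B + B)  <⟨ +-monoˡ-< (B + B) aTop<B ⟩
    B + (B + B)     ≡⟨ cong (λ b → B + (B + b)) (+-identityʳ B) ⟨
    k               <⟨ n<1+n k ⟩
    suc k           ≡⟨ |Y|+|Z|≡k+1 ⟨
    aTop + zSize    ∎)
    where open ≤-Reasoning

  3m<|Z| : 3 * m < zSize
  3m<|Z| = <-trans 3m<B (≤-<-trans (m≤m+n B B) 2B<|Z|)

  γ<|Z| : ∀ i → gamma a i < zSize
  γ<|Z| i = ≤-<-trans (countF-≤ _) 3m<|Z|

  B+12m<|Z| : B + 12 * m < zSize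
  B+12m<|Z| = <-trans (+-monoʳ-< B 12m<B) 2B<|Z|

  lowZ : ℕ
  lowZ = (zSize + 15) ∸ (B + 12 * m)

  0<lowZ : 0 < lowZ
  0<lowZ = m<n⇒0<n∸m (<-≤-trans B+12m<|Z| (m≤m+n zSize 15))

  lowZ+B+12m : lowZ + (B + 12 * m) ≡ zSize + 15
  lowZ+B+12m = m∸n+n≡m (≤-trans (<⇒≤ B+12m<|Z|) (m≤m+n zSize 15))

  m≤aTop : m ≤ aTop
  m≤aTop = ≤-trans (m≤n*m m 8) (8m≤a (lastIdx m))

  yOf : Fin m → Fin aTop
  yOf t = inject≤ t m≤aTop

  toℕ-yOf : ∀ t → toℕ (yOf t) ≡ toℕ t
  toℕ-yOf t = toℕ-inject≤ t m≤aTop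

  ⌊yOf≟yOf⌋ : ∀ s t → ⌊ yOf s ≟ yOf t ⌋ ≡ ⌊ s ≟ t ⌋
  ⌊yOf≟yOf⌋ s t with s ≟ t
  ... | yes refl = ⌊≟⌋-refl (yOf s)
  ... | no s≢t   = ⌊≟⌋-false λ e → s≢t (toℕ-injective (trans (sym (toℕ-yOf s)) (trans (cong toℕ e) (toℕ-yOf t))))

  -- Opaque because unfolding fromℕ< against the size k ∸ aTop + 1 makes type checking blow up.
  opaque
    z₀ : Fin zSize
    z₀ = fromℕ< (≤-<-trans z≤n 3m<|Z|)

    toℕ-z₀ : toℕ z₀ ≡ 0
    toℕ-z₀ = toℕ-fromℕ< (≤-<-trans z≤n 3m<|Z|)

  x-adjacent-y : ∀ j t → GV (vx j) (vy (yOf t)) ≡ true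
  x-adjacent-y j t rewrite toℕ-yOf t = trans (∨-identityʳ _) (<ᵇ-true (<-≤-trans (toℕ<n t) (≤-trans (m≤n*m m 8) (8m≤a j))))

  parentV : V → V
  parentV (vx j) = vy (yOf (f j))
  parentV (vy i) = vz z₀
  parentV (vz l) = vz z₀

  rankV : V → ℕ
  rankV (vx _) = 2
  rankV (vy _) = 1
  rankV (vz l) = if ⌊ l ≟ z₀ ⌋ then 0 else 1

  rankV-parentV : ∀ x → x ≢ vz z₀ → rankV (parentV x) < rankV x
  rankV-parentV (vx j) _ = ≤-refl
  rankV-parentV (vy i) _ rewrite ⌊≟⌋-refl z₀ = ≤-refl
  rankV-parentV (vz l) l≢z₀ rewrite ⌊≟⌋-refl z₀ | ⌊≟⌋-false (l≢z₀ ∘ cong vz) = ≤-refl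

  GV-parentV : ∀ x → x ≢ vz z₀ → GV x (parentV x) ≡ true
  GV-parentV (vx j) _ = x-adjacent-y j (f j)
  GV-parentV (vy i) _ rewrite toℕ-z₀ with toℕ i <ᵇ m
  ... | true  = trans (∨-identityʳ _) (<ᵇ-true 0<lowZ)
  ... | false = trans (∨-identityʳ _) (<ᵇ-true (m<n⇒0<n∸m (γ<|Z| (suc (toℕ i)))))
  GV-parentV (vz l) l≢z₀ rewrite ⌊≟⌋-false (l≢z₀ ∘ cong vz) = refl

  root : Fin nV
  root = embed (vz z₀)

  parent : Fin nV → Fin nV
  parent u = embed (parentV (partV u))

  rank : Fin nV → ℕ
  rank u = rankV (partV u)

  rank-parent : ∀ u → u ≢ root → rank (parent u) < rank u
  rank-parent u u≢root rewrite part-embed (parentV (partV u)) =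
    rankV-parentV (partV u) (part-≢ u≢root)

  G-parent : ∀ u → u ≢ root → G u (parent u) ≡ true
  G-parent u u≢root = begin
    G u (parent u)                                    ≡⟨ cong (λ w → G w (parent u)) (embed-part u) ⟨
    G (embed (partV u)) (embed (parentV (partV u)))  ≡⟨ G-embed (partV u) (parentV (partV u)) ⟩
    GV (partV u) (parentV (partV u))                  ≡⟨ GV-parentV (partV u) (part-≢ u≢root) ⟩
    true                                              ∎
    where open ≡-Reasoning

  open ParentTree root parent rank rank-parent

  countV : (V → Bool) → ℕ
  countV P = sumParts (λ y → if P y then 1 else 0)

  degreeInto-embed : ∀ (S : V → Bool) x → degreeInto G (S ∘ partV) (embed x) ≡ countV (λ y → S y ∧ GV x y)
  degreeInto-embed S x =
    trans (countF-cong λ v → cong (λ z → S (partV v) ∧ GV z (partV v)) (part-embed x))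
          (sumF-part (λ y → if S y ∧ GV x y then 1 else 0))

  <|Y|+|Z|⇒≤k : ∀ {d} → d < aTop + zSize → d ≤ k
  <|Y|+|Z|⇒≤k {d} h = s≤s⁻¹ (subst (suc d ≤_) |Y|+|Z|≡k+1 h)

  degree-vx : ∀ j → countV (GV (vx j)) ≤ k
  degree-vx j = begin
    countV (GV (vx j))   ≤⟨ +-monoʳ-≤ X (+-mono-≤ (countF-toℕ< (a j) below) (≤-reflexive (sumF-zero {zSize}))) ⟩
    X + (a j + 0)        ≤⟨ +-mono-≤ (countF-≤ (GV (vx j) ∘ vx)) (≤-reflexive (+-identityʳ (a j))) ⟩
    3 * m + a j          <⟨ +-mono-< 3m<B (a<B j) ⟩
    B + B                ≤⟨ m≤m+n (B + B) (B + 0) ⟩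
    B + B + (B + 0)      ≡⟨ +-assoc B B (B + 0) ⟩
    k                    ∎
    where
    open ≤-Reasoning
    X = countF (GV (vx j) ∘ vx)
    below : ∀ i → GV (vx j) (vy i) ≡ true → toℕ i < a j
    below i e = <ᵇ-sound (trans (sym (∨-identityʳ _)) e)

  degree-vy : ∀ i → m ≤ toℕ i → countV (GV (vy i)) ≤ k
  degree-vy i m≤i = <|Y|+|Z|⇒≤k (begin
    suc (γ + (Y + Z))            ≡⟨ rearrange γ Y Z ⟩
    suc Y + (γ + Z)              ≤⟨ +-mono-≤ (countF-clique-< i) (+-monoʳ-≤ γ (countF-toℕ< (zSize ∸ γ) below)) ⟩
    aTop + (γ + (zSize ∸ γ))     ≡⟨ cong (aTop +_) (m+[n∸m]≡n (<⇒≤ (γ<|Z| (suc (toℕ i))))) ⟩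
    aTop + zSize                 ∎)
    where
    open ≤-Reasoning
    γ = gamma a (suc (toℕ i))
    Y = countF (GV (vy i) ∘ vy)
    Z = countF (GV (vy i) ∘ vz)
    rearrange : ∀ x y z → suc (x + (y + z)) ≡ suc y + (x + z)
    rearrange = solve-∀
    below : ∀ l → GV (vy i) (vz l) ≡ true → toℕ l < zSize ∸ γ
    below l e rewrite <ᵇ-false m≤i = <ᵇ-sound (trans (sym (∨-identityʳ _)) e)

  degree-vz : ∀ l → countV (GV (vz l)) ≤ k
  degree-vz l = <|Y|+|Z|⇒≤k (begin
    suc (X + (Y + Z))  ≡⟨ cong (λ x → suc (x + (Y + Z))) (sumF-zero {3 * m}) ⟩
    suc (Y + Z)        ≡⟨ +-suc Y Z ⟨
    Y + suc Z          ≤⟨ +-mono-≤ (countF-≤ (GV (vz l) ∘ vy)) (countF-clique-< l) ⟩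
    aTop + zSize       ∎)
    where
    open ≤-Reasoning
    X = countF (GV (vz l) ∘ vx)
    Y = countF (GV (vz l) ∘ vy)
    Z = countF (GV (vz l) ∘ vz)

  leaf-congestion : ∀ x → (∀ y → parentV y ≢ x) → countV (GV x) ≤ k
                  → EdgeCongestionLE G tree (embed x) (parent (embed x)) k
  leaf-congestion x childless deg =
    congestion-leaf (tree-leaf λ w _ e → childless (partV w) (embed-injective e))
                    (subst (_≤ k) (sym (degreeInto-embed (λ _ → true) x)) deg)

  module Block (t : Fin m) where

    yₜ : Fin aTop
    yₜ = yOf t

    inBlock : Fin (3 * m) → Bool
    inBlock j = ⌊ f j ≟ t ⌋

    cutOffV : V → Bool
    cutOffV (vx j) = inBlock j
    cutOffV (vy i) = ⌊ i ≟ yₜ ⌋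
    cutOffV (vz _) = false

    cutOff : Fin nV → Bool
    cutOff = cutOffV ∘ partV

    outDegree : V → ℕ
    outDegree x = countV (λ y → not (cutOffV y) ∧ GV x y)

    others : ℕ
    others = countF (not ∘ inBlock)

    block-size : countF inBlock ≡ 3
    block-size = block-card≡3 inBlock 1≤B B<4a 2a<B (f-blocks t)

    others+3 : others + 3 ≡ 3 * m
    others+3 = trans (+-comm others 3) (trans (cong (_+ others) (sym block-size)) (countF-complement inBlock))

    others-≤ : ∀ x → countF (λ j → not (inBlock j) ∧ GV x (vx j)) ≤ others
    others-≤ x = countF-mono {3 * m} λ j e → ∧-conicalˡ _ _ e

    cut-size : edgesBetween G cutOff (not ∘ cutOff) ≡ sumF (restrict inBlock (outDegree ∘ vx)) + (outDegree (vy yₜ) + 0)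
    cut-size = begin
      edgesBetween G cutOff (not ∘ cutOff)                    ≡⟨ edgesBetween-degreeInto G cutOff (not ∘ cutOff) ⟩
      sumF (restrict cutOff (degreeInto G (not ∘ cutOff)))    ≡⟨ sumF-cong pointwise ⟩
      sumF ((λ y → if cutOffV y then outDegree y else 0) ∘ partV)
        ≡⟨ sumF-part (λ y → if cutOffV y then outDegree y else 0) ⟩
      X + (sumF (restrict (λ i → ⌊ i ≟ yₜ ⌋) (outDegree ∘ vy)) + sumF {zSize} (λ _ → 0))
        ≡⟨ cong (X +_) (cong₂ _+_ (sumF-point yₜ (outDegree ∘ vy)) (sumF-zero {zSize})) ⟩
      X + (outDegree (vy yₜ) + 0) ∎
      where
      open ≡-Reasoning
      X = sumF (restrict inBlock (outDegree ∘ vx))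
      pointwise : ∀ v → restrict cutOff (degreeInto G (not ∘ cutOff)) v ≡ (if cutOffV (partV v) then outDegree (partV v) else 0)
      pointwise v = cong (λ d → if cutOffV (partV v) then d else 0)
        (trans (cong (degreeInto G (not ∘ cutOff)) (sym (embed-part v))) (degreeInto-embed (not ∘ cutOffV) (partV v)))

    outDegree-vx : ∀ j → outDegree (vx j) + 1 ≤ others + a j
    outDegree-vx j = begin
      X + (Y + Z) + 1    ≡⟨ cong (λ z → X + (Y + z) + 1) (sumF-zero {zSize}) ⟩
      X + (Y + 0) + 1    ≡⟨ rearrange X Y ⟩
      X + suc Y          ≡⟨ cong (X +_) (countF-except yₜ (x-adjacent-y j t)) ⟩
      X + countF (GV (vx j) ∘ vy)
                         ≤⟨ +-mono-≤ (others-≤ (vx j)) (countF-toℕ< (a j) below) ⟩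
      others + a j       ∎
      where
      open ≤-Reasoning
      X = countF (λ j′ → not (inBlock j′) ∧ GV (vx j) (vx j′))
      Y = countF (λ i → not ⌊ i ≟ yₜ ⌋ ∧ GV (vx j) (vy i))
      Z = countF (λ l → true ∧ GV (vx j) (vz l))
      rearrange : ∀ x y → x + (y + 0) + 1 ≡ x + suc y
      rearrange = solve-∀
      below : ∀ i → GV (vx j) (vy i) ≡ true → toℕ i < a j
      below i e = <ᵇ-sound (trans (sym (∨-identityʳ _)) e)

    outDegree-vy : outDegree (vy yₜ) + 1 ≤ others + aTop + lowZ
    outDegree-vy = begin
      X + (Y + Z) + 1    ≡⟨ rearrange X Y Z ⟩
      X + suc Y + Z      ≤⟨ +-mono-≤ (+-mono-≤ (others-≤ (vy yₜ)) (countF-except-< yₜ (GV (vy yₜ) ∘ vy)))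
                                     (countF-toℕ< lowZ below) ⟩
      others + aTop + lowZ ∎
      where
      open ≤-Reasoning
      X = countF (λ j → not (inBlock j) ∧ GV (vy yₜ) (vx j))
      Y = countF (λ i → not ⌊ i ≟ yₜ ⌋ ∧ GV (vy yₜ) (vy i))
      Z = countF (λ l → true ∧ GV (vy yₜ) (vz l))
      rearrange : ∀ x y z → x + (y + z) + 1 ≡ x + suc y + z
      rearrange = solve-∀
      yₜ<m : (toℕ yₜ <ᵇ m) ≡ true
      yₜ<m = <ᵇ-true (subst (_< m) (sym (toℕ-yOf t)) (toℕ<n t))
      below : ∀ l → GV (vy yₜ) (vz l) ≡ true → toℕ l < lowZ
      below l e rewrite yₜ<m = <ᵇ-sound (trans (sym (∨-identityʳ _)) e)

    in-block-bound : sumF (restrict inBlock (outDegree ∘ vx)) + 3 ≤ others * 3 + B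
    in-block-bound = begin
      sumF (restrict inBlock (outDegree ∘ vx)) + 3              ≡⟨ cong (sumF (restrict inBlock (outDegree ∘ vx)) +_) block-size ⟨
      sumF (restrict inBlock (outDegree ∘ vx)) + countF inBlock ≡⟨ sumF-restrict-+ inBlock (outDegree ∘ vx) (λ _ → 1) ⟨
      sumF (restrict inBlock (λ j → outDegree (vx j) + 1))      ≤⟨ sumF-restrict-mono inBlock (λ j _ → outDegree-vx j) ⟩
      sumF (restrict inBlock (λ j → others + a j))              ≡⟨ sumF-restrict-+ inBlock (λ _ → others) a ⟩
      sumF (restrict inBlock (λ _ → others)) + blockSum a f t   ≡⟨ cong₂ _+_ (sumF-restrict-const inBlock others) (f-blocks t) ⟩
      others * countF inBlock + B                               ≡⟨ cong (λ s → others * s + B) block-size ⟩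
      others * 3 + B                                            ∎
      where open ≤-Reasoning

    cut-≤-k : edgesBetween G cutOff (not ∘ cutOff) ≤ k
    cut-≤-k = +-cancelʳ-≤ 16 _ _ (begin
      edgesBetween G cutOff (not ∘ cutOff) + 16      ≡⟨ cong (_+ 16) cut-size ⟩
      X + (Y + 0) + 16                               ≡⟨ regroup₁ X Y ⟩
      (X + 3) + (Y + 1) + 12                         ≤⟨ +-monoˡ-≤ 12 (+-mono-≤ in-block-bound outDegree-vy) ⟩
      (others * 3 + B) + (others + aTop + lowZ) + 12 ≡⟨ regroup₂ others B aTop lowZ ⟩
      4 * (others + 3) + aTop + (lowZ + B)           ≡⟨ cong (λ o → 4 * o + aTop + (lowZ + B)) others+3 ⟩
      4 * (3 * m) + aTop + (lowZ + B)                ≡⟨ regroup₃ m aTop lowZ B ⟩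
      aTop + (lowZ + (B + 12 * m))                   ≡⟨ cong (aTop +_) lowZ+B+12m ⟩
      aTop + (zSize + 15)                            ≡⟨ +-assoc aTop zSize 15 ⟨
      aTop + zSize + 15                              ≡⟨ cong (_+ 15) |Y|+|Z|≡k+1 ⟩
      suc k + 15                                     ≡⟨ +-suc k 15 ⟨
      k + 16                                         ∎)
      where
      open ≤-Reasoning
      X = sumF (restrict inBlock (outDegree ∘ vx))
      Y = outDegree (vy yₜ)
      regroup₁ : ∀ x y → x + (y + 0) + 16 ≡ (x + 3) + (y + 1) + 12
      regroup₁ = solve-∀
      regroup₂ : ∀ o b y z → (o * 3 + b) + (o + y + z) + 12 ≡ 4 * (o + 3) + y + (z + b)
      regroup₂ = solve-∀
      regroup₃ : ∀ n y z b → 4 * (3 * n) + y + (z + b) ≡ y + (z + (b + 12 * n))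
      regroup₃ = solve-∀

    cutOffV-parentV : ∀ y → y ≢ vy yₜ → cutOffV y ≡ cutOffV (parentV y)
    cutOffV-parentV (vx j) _    = sym (⌊yOf≟yOf⌋ (f j) t)
    cutOffV-parentV (vy i) i≢yₜ = ⌊≟⌋-false (i≢yₜ ∘ cong vy)
    cutOffV-parentV (vz l) _    = refl

    congestion : EdgeCongestionLE G tree (embed (vy yₜ)) (parent (embed (vy yₜ))) k
    congestion = congestion-≤-cut tree-symmetric (tree-cut-closed _ cutOff cutOff-parent) cutOff-yₜ cutOff-root cut-≤-k
      where
      cutOff-parent : ∀ w → w ≢ root → w ≢ embed (vy yₜ) → cutOff w ≡ cutOff (parent w)
      cutOff-parent w _ w≢yₜ =
        trans (cutOffV-parentV (partV w) (part-≢ w≢yₜ)) (cong cutOffV (sym (part-embed (parentV (partV w)))))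
      cutOff-yₜ : cutOff (embed (vy yₜ)) ≡ true
      cutOff-yₜ = trans (cong cutOffV (part-embed (vy yₜ))) (⌊≟⌋-refl yₜ)
      cutOff-root : cutOff (parent (embed (vy yₜ))) ≡ false
      cutOff-root rewrite part-embed (vy yₜ) | part-embed (vz z₀) = refl

  edge-congestion : ∀ x → x ≢ vz z₀ → EdgeCongestionLE G tree (embed x) (parent (embed x)) k
  edge-congestion (vx j) _ = leaf-congestion (vx j) (λ { (vx _) () ; (vy _) () ; (vz _) () }) (degree-vx j)
  edge-congestion (vy i) _ with toℕ i <? m
  ... | yes i<m = subst (λ y → EdgeCongestionLE G tree (embed (vy y)) (parent (embed (vy y))) k) yₜ≡i (Block.congestion t)
    where
    t = fromℕ< i<m
    yₜ≡i : yOf t ≡ i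
    yₜ≡i = toℕ-injective (trans (toℕ-yOf t) (toℕ-fromℕ< i<m))
  ... | no i≮m  = leaf-congestion (vy i) childless (degree-vy i (≮⇒≥ i≮m))
    where
    childless : ∀ y → parentV y ≢ vy i
    childless (vx j) refl = i≮m (subst (_< m) (sym (toℕ-yOf (f j))) (toℕ<n (f j)))
  edge-congestion (vz l) l≢z₀ = leaf-congestion (vz l) childless (degree-vz l)
    where
    childless : ∀ y → parentV y ≢ vz l
    childless (vy _) refl = l≢z₀ refl
    childless (vz _) refl = l≢z₀ refl

  stc≤k : StcLE G k
  stc≤k = tree , tree-spanning G-symmetric G-parent , tree-congestion G-symmetric congestion
    where
    congestion : ∀ u → u ≢ root → EdgeCongestionLE G tree u (parent u) k
    congestion u u≢root = subst (λ w → EdgeCongestionLE G tree w (parent w) k) (embed-part u)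
                                (edge-congestion (partV u) (part-≢ u≢root))

lemma5 : (m : ℕ) → {{_ : NonZero m}} → (a : Fin (3 * m) → ℕ) → (B : ℕ)
    → (∀ i j → i ≤ᶠ j → a i ≤ a j)
    → (∀ i → 1 ≤ a i) → 1 ≤ B
    → sumF a ≡ m * B
    → (∀ i → B < 4 * a i) → (∀ i → 2 * a i < B)
    → (∀ i → 8 * m ≤ a i)
    → Σ (Fin (3 * m) → Fin m) (λ f → ∀ t → blockSum a f t ≡ B)
    → StcLE (Construction.G m a B) (Construction.k m a B)
lemma5 m a B _ _ 1≤B _ B<4a 2a<B 8m≤a (f , f-blocks) =
  LowCongestionTree.stc≤k m a B 1≤B B<4a 2a<B 8m≤a f f-blocks
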